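{- Let $G=(V,E)$ be a connected undirected graph with a token placement in which not every token is at its target vertex. Then there exists a happy swap chain or an unhappy swap.
   Context: Token swapping setting: each vertex of $G$ holds exactly one token, each token has a target vertex, the targets form a bijection between tokens and vertices, and a swap exchanges the tokens on the two endpoints of an edge. Distances are graph distances in $G$. An unhappy swap is a swap along an edge where one of the two swapped tokens is already on its target vertex and the other token reduces its distance to its target vertex by one. A happy swap chain of length $\ell\ge 1$: take a path of $\ell+1$ distinct vertices $v_1,\dots,v_{\ell+1}$ in $G$ and swap the tokens along the edges $(v_1,v_2),(v_2,v_3),\dots,(v_\ell,v_{\ell+1})$ in this order, so that the token initially on $v_1$ ends on $v_{\ell+1}$ and each token initially on $v_j$ ($2\le j\le \ell+1$) ends on $v_{j-1}$; this is called a happy swap chain if every token that is moved ends at a vertex whose distance to its target is smaller by at least $1$ than before. (A happy swap chain may consist of a single swap.) -}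

module Defs where

open import Data.Nat using (ℕ; zero; suc; _≤_; _<_)
open import Data.Fin using (Fin; zero; suc; inject₁; fromℕ)
open import Function.Definitions using (Injective)
open import Data.Bool using (Bool; true; false)
open import Data.Product using (Σ; ∃; ∃-syntax; _×_; _,_)
open import Relation.Binary.PropositionalEquality using (_≡_)

record Graph (n : ℕ) : Set where
  field
    adj   : Fin n → Fin n → Bool
    sym   : ∀ u v → adj u v ≡ adj v u
    irrfl : ∀ v → adj v v ≡ false

module _ {n : ℕ} (G : Graph n) where
  open Graph G

  Edge : Fin n → Fin n → Set
  Edge u v = adj u v ≡ true

  data Walk : Fin n → Fin n → ℕ → Set where
    nil  : ∀ {u} → Walk u u zero
    cons : ∀ {u w v k} → Edge u w → Walk w v k → Walk u v (suc k)

  Connected : Set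
  Connected = ∀ u v → ∃[ k ] Walk u v k

  Dist : Fin n → Fin n → ℕ → Set
  Dist u v d = Walk u v d × (∀ k → Walk u v k → d ≤ k)

  Closer : (a b t : Fin n) → Set
  Closer a b t = ∃[ d ] ∃[ d' ] (Dist a t d × Dist b t d' × d' < d)

  CloserByOne : (a b t : Fin n) → Set
  CloserByOne a b t = ∃[ d ] (Dist a t (suc d) × Dist b t d)

  -- A token placement is recorded by tau : Fin n → Fin n, where tau v is
  -- the target vertex of the token currently on v; since targets form a
  -- bijection between tokens and vertices, tau is injective (a permutation).

  UnhappySwap : (Fin n → Fin n) → Set
  UnhappySwap tau = ∃[ u ] ∃[ v ]
    (Edge u v × tau u ≡ u × CloserByOne v u (tau v))

  -- A happy swap chain of length ℓ+1 ≥ 1 along the path p 0, …, p (ℓ+1)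
  -- of ℓ+2 distinct vertices: the token on p 0 ends on p (ℓ+1), the token on
  -- p (i+1) ends on p i, and each moved token gets closer to its target by
  -- at least one.
  HappySwapChain : (Fin n → Fin n) → Set
  HappySwapChain tau = ∃[ ℓ ] Σ (Fin (suc (suc ℓ)) → Fin n) λ p →
      Injective _≡_ _≡_ p
    × (∀ (i : Fin (suc ℓ)) → Edge (p (inject₁ i)) (p (suc i)))
    × Closer (p zero) (p (fromℕ (suc ℓ))) (tau (p zero))
    × (∀ (i : Fin (suc ℓ)) → Closer (p (suc i)) (p (inject₁ i)) (tau (p (suc i))))

module Submission where

open import Defs
open import Data.Nat using (ℕ)
open import Data.Fin using (Fin)
open import Data.Product using (∃-syntax)
open import Data.Sum using (_⊎_)
open import Relation.Binary.PropositionalEquality using (_≢_)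
open import Function.Definitions using (Injective)
open import Relation.Binary.PropositionalEquality using (_≡_)

open import Data.Nat using (zero; suc; _∸_; _+_; _≤_; _<_; s≤s⁻¹)
open import Data.Nat.Properties
  using (≤-refl; +-suc; <⇒≱; ≮⇒≥; <-cmp; 1+n≢n; +-monoʳ-<; +-∸-assoc;
         m∸n≤m; m∸n+n≡m; n∸n≡0; ∸-cancelˡ-≡; anyUpTo?)
open import Data.Nat.Induction using (<-rec)
open import Data.Nat.GeneralisedArithmetic using (fold; fold-+)
open import Data.Fin using (zero; suc; toℕ; inject₁; fromℕ)
open import Data.Fin.Properties
  using (any?; pigeonhole; toℕ-injective; toℕ-inject₁; toℕ-fromℕ; toℕ≤pred[n])
  renaming (_≟_ to _≟ᶠ_)
open import Data.Bool using (true)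
open import Data.Bool.Properties using () renaming (_≟_ to _≟ᵇ_)
open import Data.Product using (_×_; _,_; proj₁; proj₂)
open import Data.Sum using (inj₁; inj₂)
open import Data.Empty using (⊥-elim)
open import Function using (_∘_)
open import Relation.Nullary using (¬_; Dec; yes; no)
open import Relation.Nullary.Decidable using (_×-dec_)
open import Relation.Unary using (Pred; Decidable)
open import Relation.Binary using (DecidableEquality; tri<; tri≈; tri>)
open import Relation.Binary.PropositionalEquality
  using (refl; sym; trans; cong; subst; module ≡-Reasoning)

-- Let every misplaced token point to a neighbour one step closer to its
-- target along a shortest path, and every placed token to its own vertex.
-- Following these pointers from a misplaced token must eventually cycle.
-- If the cycle is a fixed point, its token is placed, and at the first
-- placed vertex along the way the token arriving from the previous vertex
-- makes an unhappy swap.  Otherwise the cycle has at least two vertices;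
-- rotating the tokens of a primitive cycle backwards along it, i.e.
-- sending each token to the vertex it points to, is a happy swap chain.

module _ {p} {P : Pred ℕ p} (P? : Decidable P) where

  least-witness : ∀ {k} → P k → ∃[ m ] (P m × ∀ j → P j → m ≤ j)
  least-witness {k} = <-rec _ search k
    where
    search : ∀ k → (∀ {j} → j < k → P j → ∃[ m ] (P m × ∀ j → P j → m ≤ j)) →
             P k → ∃[ m ] (P m × ∀ j → P j → m ≤ j)
    search k smaller Pk with anyUpTo? P? k
    ... | yes (j , j<k , Pj) = smaller j<k Pj
    ... | no none            = k , Pk , λ j Pj → ≮⇒≥ (λ j<k → none (j , j<k , Pj))

  first-transition : ¬ P 0 → ∀ {k} → P k → ∃[ j ] (¬ P j × P (suc j))
  first-transition ¬P0 Pk with least-witness Pk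
  ... | zero  , P0 , _       = ⊥-elim (¬P0 P0)
  ... | suc j , Pj+1 , least = j , (λ Pj → <⇒≱ ≤-refl (least j Pj)) , Pj+1

module _ {a} {A : Set a} (_≟_ : DecidableEquality A) (f : A → A) where

  -- The least period m is primitive: a repetition f^i y = f^j y with
  -- i < j ≤ m would make (m ∸ j) + i a smaller one.
  primitive-cycle : ∀ {y p} → fold y f (suc p) ≡ y →
    ∃[ m ] (fold y f (suc m) ≡ y ×
            ∀ {i j} → i ≤ m → j ≤ m → fold y f i ≡ fold y f j → i ≡ j)
  primitive-cycle {y} {p} periodic
    with least-witness {P = λ k → fold y f (suc k) ≡ y} (λ k → fold y f (suc k) ≟ y) {p} periodic
  ... | m , cycle , least = m , cycle , injective
    where
    no-repetition : ∀ {i j} → i < j → j ≤ m → fold y f i ≢ fold y f j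
    no-repetition {i} {j} i<j j≤m repeat =
      <⇒≱ (subst (m∸j + i <_) (m∸n+n≡m j≤m) (+-monoʳ-< m∸j i<j)) (least (m∸j + i) shorter)
      where
      open ≡-Reasoning
      m∸j : ℕ
      m∸j = m ∸ j
      shorter : fold y f (suc m∸j + i) ≡ y
      shorter = begin
        fold y f (suc m∸j + i)             ≡⟨ fold-+ y f (suc m∸j) ⟩
        fold (fold y f i) f (suc m∸j)      ≡⟨ cong (λ z → fold z f (suc m∸j)) repeat ⟩
        fold (fold y f j) f (suc m∸j)      ≡⟨ fold-+ y f (suc m∸j) ⟨
        fold y f (suc (m∸j + j))           ≡⟨ cong (λ k → fold y f (suc k)) (m∸n+n≡m j≤m) ⟩
        fold y f (suc m)                   ≡⟨ cycle ⟩
        y                                  ∎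
    injective : ∀ {i j} → i ≤ m → j ≤ m → fold y f i ≡ fold y f j → i ≡ j
    injective {i} {j} i≤m j≤m repeat with <-cmp i j
    ... | tri< i<j _ _ = ⊥-elim (no-repetition i<j j≤m repeat)
    ... | tri≈ _ i≡j _ = i≡j
    ... | tri> _ _ j<i = ⊥-elim (no-repetition j<i i≤m (sym repeat))

eventually-periodic : ∀ {n} (f : Fin n → Fin n) x →
  ∃[ c ] ∃[ p ] fold (fold x f c) f (suc p) ≡ fold x f c
eventually-periodic {n} f x
  with i , j , i<j , repeat ← pigeonhole ≤-refl (λ (k : Fin (suc n)) → fold x f (toℕ k)) =
  toℕ i , gap , (begin
    fold (fold x f (toℕ i)) f (suc gap)  ≡⟨ fold-+ x f (suc gap) ⟨
    fold x f (suc gap + toℕ i)           ≡⟨ cong (fold x f) (trans (sym (+-suc gap (toℕ i))) (m∸n+n≡m i<j)) ⟩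
    fold x f (toℕ j)                     ≡⟨ repeat ⟨
    fold x f (toℕ i)                     ∎)
  where
  open ≡-Reasoning
  gap : ℕ
  gap = toℕ j ∸ suc (toℕ i)

module _ {n} (G : Graph n) where
  open Graph G using (adj; irrfl)

  Edge-sym : ∀ {u v} → Edge G u v → Edge G v u
  Edge-sym {u} {v} e = trans (Graph.sym G v u) e

  Edge-irreflexive : ∀ {v} → ¬ Edge G v v
  Edge-irreflexive {v} e with trans (sym e) (irrfl v)
  ... | ()

  walk-zero : ∀ {u v} → Walk G u v zero → u ≡ v
  walk-zero nil = refl

  walk? : ∀ k u v → Dec (Walk G u v k)
  walk? zero u v with u ≟ᶠ v
  ... | yes refl = yes nil
  ... | no u≢v = no λ w → u≢v (walk-zero w)
  walk? (suc k) u v with any? (λ w → (adj u w ≟ᵇ true) ×-dec walk? k w v)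
  ... | yes (w , e , W) = yes (cons e W)
  ... | no none = no λ { (cons e W) → none (_ , e , W) }

  shortest-walk : Connected G → ∀ u v → ∃[ d ] Dist G u v d
  shortest-walk conn u v with k , W ← conn u v = least-witness (λ k → walk? k u v) W

  Dist-first-step : ∀ {u v d} → Dist G u v (suc d) → ∃[ w ] (Edge G u w × Dist G w v d)
  Dist-first-step (cons e W , shortest) = _ , e , W , λ k Wk → s≤s⁻¹ (shortest (suc k) (cons e Wk))

  CloserByOne⇒Closer : ∀ {a b t} → CloserByOne G a b t → Closer G a b t
  CloserByOne⇒Closer (d , D , D′) = suc d , d , D , D′ , ≤-refl

module Pointers {n} (G : Graph n) (conn : Connected G) (tau : Fin n → Fin n) where

  Advances : Fin n → Fin n → Set
  Advances z w = Edge G z w × CloserByOne G z w (tau z)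

  advance : ∀ z → tau z ≡ z ⊎ ∃[ w ] Advances z w
  advance z with tau z ≟ᶠ z
  ... | yes home = inj₁ home
  ... | no away with shortest-walk G conn z (tau z)
  ...   | zero  , W , _ = ⊥-elim (away (sym (walk-zero G W)))
  ...   | suc d , D     with w , e , D′ ← Dist-first-step G D = inj₂ (w , e , d , D , D′)

  next : Fin n → Fin n
  next z with advance z
  ... | inj₁ _       = z
  ... | inj₂ (w , _) = w

  next-fixed⇒home : ∀ z → next z ≡ z → tau z ≡ z
  next-fixed⇒home z with advance z
  ... | inj₁ home          = λ _ → home
  ... | inj₂ (_ , e , _)   = λ { refl → ⊥-elim (Edge-irreflexive G e) }

  next-advances : ∀ z → next z ≢ z → Advances z (next z)
  next-advances z with advance z
  ... | inj₁ _           = λ moved → ⊥-elim (moved refl)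
  ... | inj₂ (_ , adv)   = λ _ → adv

  unhappy-swap : ∀ {z} → tau z ≢ z → tau (next z) ≡ next z → UnhappySwap G tau
  unhappy-swap {z} away arrived with e , closer ← next-advances z (away ∘ next-fixed⇒home z) =
    next z , z , Edge-sym G e , arrived , closer

  next-moves-to : ∀ {z w} → next z ≡ w → w ≢ z → Edge G w z × Closer G z w (tau z)
  next-moves-to {z} refl moved with e , closer ← next-advances z moved =
    Edge-sym G e , CloserByOne⇒Closer G closer

  happy-swap-chain : ∀ ℓ y → fold y next (suc (suc ℓ)) ≡ y →
    (∀ {i j} → i ≤ suc ℓ → j ≤ suc ℓ → fold y next i ≡ fold y next j → i ≡ j) →
    HappySwapChain G tau
  happy-swap-chain ℓ y cycle orbit-injective =
    ℓ , p , p-injective ,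
    (λ i → proj₁ (moves (next-suc i) (inject₁≢suc i))) ,
    proj₂ (moves {fromℕ (suc ℓ)} {zero} next-zero λ ()) ,
    (λ i → proj₂ (moves (next-suc i) (inject₁≢suc i)))
    where
    open ≡-Reasoning
    -- the cycle read backwards, so that next sends p (suc i) to p i
    p : Fin (suc (suc ℓ)) → Fin n
    p i = fold y next (suc ℓ ∸ toℕ i)

    p-injective : Injective _≡_ _≡_ p
    p-injective {i} {j} same = toℕ-injective
      (∸-cancelˡ-≡ (toℕ≤pred[n] i) (toℕ≤pred[n] j)
        (orbit-injective (m∸n≤m _ (toℕ i)) (m∸n≤m _ (toℕ j)) same))

    next-suc : ∀ i → next (p (suc i)) ≡ p (inject₁ i)
    next-suc i = cong (fold y next) (begin
      suc (ℓ ∸ toℕ i)              ≡⟨ +-∸-assoc 1 (toℕ≤pred[n] i) ⟨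
      suc ℓ ∸ toℕ i                ≡⟨ cong (suc ℓ ∸_) (toℕ-inject₁ i) ⟨
      suc ℓ ∸ toℕ (inject₁ i)      ∎)

    next-zero : next (p zero) ≡ p (fromℕ (suc ℓ))
    next-zero = trans cycle (cong (fold y next) (begin
      0                            ≡⟨ n∸n≡0 (suc ℓ) ⟨
      suc ℓ ∸ suc ℓ                ≡⟨ cong (suc ℓ ∸_) (toℕ-fromℕ (suc ℓ)) ⟨
      suc ℓ ∸ toℕ (fromℕ (suc ℓ))  ∎))

    inject₁≢suc : ∀ (i : Fin (suc ℓ)) → inject₁ i ≢ suc i
    inject₁≢suc i same = 1+n≢n (trans (cong toℕ (sym same)) (toℕ-inject₁ i))

    moves : ∀ {i j} → next (p j) ≡ p i → i ≢ j → Edge G (p i) (p j) × Closer G (p j) (p i) (tau (p j))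
    moves step i≢j = next-moves-to step (i≢j ∘ p-injective)

  happy-chain-or-unhappy-swap : ∀ {v} → tau v ≢ v → HappySwapChain G tau ⊎ UnhappySwap G tau
  happy-chain-or-unhappy-swap {v} away
    with c , p , periodic ← eventually-periodic next v
    with primitive-cycle _≟ᶠ_ next {fold v next c} {p} periodic
  ... | zero , fixed , _ =
    let _ , away′ , home = first-transition (λ k → tau (fold v next k) ≟ᶠ fold v next k)
                                            away {c} (next-fixed⇒home _ fixed)
    in inj₂ (unhappy-swap away′ home)
  ... | suc ℓ , cycle , orbit-injective = inj₁ (happy-swap-chain ℓ _ cycle orbit-injective)

lemma2 : ∀ {n : ℕ} (G : Graph n) → Connected G →
    (tau : Fin n → Fin n) → Injective _≡_ _≡_ tau →
    (∃[ v ] tau v ≢ v) →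
    HappySwapChain G tau ⊎ UnhappySwap G tau
lemma2 G conn tau _ (v , away) = Pointers.happy-chain-or-unhappy-swap G conn tau away
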